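{- Let $D=(F,R,>)$ be a finite propositional defeasible theory, $q$ a literal, and let $E=(+\Delta_E,-\Delta_E,+\partial_E,-\partial_E)=\bigcup_{n<\omega}\mathcal{T}_D\uparrow n$ be the limit (pointwise union) of all finite elements of the Kleene sequence of $\mathcal{T}_D$ from $\bot$. Then: $D\vdash+\Delta q$ iff $q\in+\Delta_E$; $D\vdash-\Delta q$ iff $q\in-\Delta_E$; $D\vdash+\partial q$ iff $q\in+\partial_E$; $D\vdash-\partial q$ iff $q\in-\partial_E$.
   Context: Literals are atoms $p$ or negated atoms $\neg p$; for a literal $q$, $\sim q$ is its complement. A defeasible theory $D=(F,R,>)$ consists of a finite set $F$ of literals (facts), a finite set $R$ of propositional rules, and a binary relation $>$ on $R$ whose transitive closure is irreflexive. Each rule $r$ has a unique label, an antecedent $A(r)$ (finite set of literals), a head $C(r)$ (a literal) and a kind: strict ($\to$), defeasible ($\Rightarrow$) or defeater ($\leadsto$). $R_s$: strict rules; $R_{sd}$: strict or defeasible rules; $R[q]$, $R_s[q]$, $R_{sd}[q]$: those with head $q$. A derivation in $D$ is a finite sequence $P(1),\dots,P(n)$ of tagged literals $+\Delta q,-\Delta q,+\partial q,-\partial q$ such that for each $i$ (with $P(1..i)$ the initial segment of length $i$): ($+\Delta$) if $P(i+1)=+\Delta q$ then $q\in F$ or $\exists r\in R_s[q]\,\forall a\in A(r):+\Delta a\in P(1..i)$; ($-\Delta$) if $P(i+1)=-\Delta q$ then $q\notin F$ and $\forall r\in R_s[q]\,\exists a\in A(r): -\Delta a\in P(1..i)$;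 ($+\partial$) if $P(i+1)=+\partial q$ then either $+\Delta q\in P(1..i)$, or: $\exists r\in R_{sd}[q]\,\forall a\in A(r):+\partial a\in P(1..i)$, and $-\Delta\sim q\in P(1..i)$, and for every $s\in R[\sim q]$ either $\exists a\in A(s):-\partial a\in P(1..i)$ or $\exists t\in R_{sd}[q]$ with $t>s$ and $\forall a\in A(t):+\partial a\in P(1..i)$; ($-\partial$) if $P(i+1)=-\partial q$ then $-\Delta q\in P(1..i)$ and either $\forall r\in R_{sd}[q]\,\exists a\in A(r):-\partial a\in P(1..i)$, or $+\Delta\sim q\in P(1..i)$, or $\exists s\in R[\sim q]$ with $\forall a\in A(s):+\partial a\in P(1..i)$ and for every $t\in R_{sd}[q]$ either $\exists a\in A(t):-\partial a\in P(1..i)$ or $t\not> s$. $D\vdash L$ means $L$ occurs in some derivation in $D$. An extension is a 4-tuple $(+\Delta,-\Delta,+\partial,-\partial)$ of sets of literals, ordered pointwise by inclusion, with least element $\bot=(\emptyset,\emptyset,\emptyset,\emptyset)$. The operator $\mathcal{T}_D(+\Delta,-\Delta,+\partial,-\partial)=(+\Delta',-\Delta',+\partial',-\partial')$ is: $+\Delta'=F\cup\{q\mid\exists r\in R_s[q]:A(r)\subseteq+\Delta\}$; $-\Delta'=-\Delta\cup(\{q\mid\forall r\in R_s[q]:A(r)\cap-\Delta\neq\emptyset\}\setminus F)$; $+\partial'=+\Delta\cup\{q\mid \exists r\in R_{sd}[q]:A(r)\subseteq+\partial$, $\sim q\in-\Delta$, and $\forall s\in R[\sim q]$ either $A(s)\cap-\partial\neq\emptyset$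 or $\exists t\in R_{sd}[q]$ with $A(t)\subseteq+\partial$ and $t>s\}$; $-\partial'=\{q\in-\Delta\mid (\forall r\in R_{sd}[q]:A(r)\cap-\partial\neq\emptyset)$, or $\sim q\in+\Delta$, or $\exists s\in R[\sim q]$ with $A(s)\subseteq+\partial$ and $\forall t\in R_{sd}[q]$ either $A(t)\cap-\partial\neq\emptyset$ or $t\not>s\}$. The Kleene sequence is $\mathcal{T}_D\uparrow 0=\bot$, $\mathcal{T}_D\uparrow(n+1)=\mathcal{T}_D(\mathcal{T}_D\uparrow n)$. -}

module Defs where

open import Data.Nat using (ℕ; zero; suc)
open import Data.Product using (Σ; ∃; _×_; _,_; proj₁; proj₂)
open import Data.Sum using (_⊎_)
open import Data.List using (List; map)
open import Data.List.Membership.Propositional using (_∈_; _∉_)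
open import Data.List.Relation.Unary.Unique.Propositional using (Unique)
open import Relation.Binary.PropositionalEquality using (_≡_)
open import Relation.Binary.Construct.Closure.Transitive using (TransClosure)
open import Relation.Nullary using (¬_)
open import Function.Bundles using (_⇔_)

data Literal : Set where
  pos : ℕ → Literal
  neg : ℕ → Literal

∼_ : Literal → Literal
∼ pos p = neg p
∼ neg p = pos p

data Kind : Set where
  strict defeasible defeater : Kind

record Rule : Set where
  constructor mkRule
  field
    label : ℕ
    kind  : Kind
    ante  : List Literal
    head  : Literal
open Rule public

record Theory : Set where
  constructor mkTheory
  field
    facts : List Literal
    rules : List Rule
    sup   : List (ℕ × ℕ)
open Theory public

_≻[_]_ : Rule → Theory → Rule → Set
t ≻[ D ] s = (label t , label s) ∈ sup D

IsSD : Rule → Set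
IsSD r = kind r ≡ strict ⊎ kind r ≡ defeasible

_≻_on_ : Theory → Rule → Rule → Set
(D ≻ t on s) = t ∈ rules D × s ∈ rules D × t ≻[ D ] s

WellFormed : Theory → Set
WellFormed D =
  Unique (map label (rules D)) ×
  (∀ {a b} → (a , b) ∈ sup D →
     (∃ λ t → t ∈ rules D × label t ≡ a) × (∃ λ s → s ∈ rules D × label s ≡ b)) ×
  (∀ r → ¬ TransClosure (λ t s → D ≻ t on s) r r)

data Tagged : Set where
  +Δ -Δ +∂ -∂ : Literal → Tagged

module _ (D : Theory) where

  Ok : List Tagged → Tagged → Set
  Ok P (+Δ q) =
    q ∈ facts D ⊎
    (∃ λ r → r ∈ rules D × kind r ≡ strict × head r ≡ q ×
       (∀ a → a ∈ ante r → +Δ a ∈ P))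
  Ok P (-Δ q) =
    q ∉ facts D ×
    (∀ r → r ∈ rules D → kind r ≡ strict → head r ≡ q →
       ∃ λ a → a ∈ ante r × -Δ a ∈ P)
  Ok P (+∂ q) =
    +Δ q ∈ P ⊎
    ((∃ λ r → r ∈ rules D × IsSD r × head r ≡ q ×
        (∀ a → a ∈ ante r → +∂ a ∈ P)) ×
     -Δ (∼ q) ∈ P ×
     (∀ s → s ∈ rules D → head s ≡ ∼ q →
        (∃ λ a → a ∈ ante s × -∂ a ∈ P) ⊎
        (∃ λ t → t ∈ rules D × IsSD t × head t ≡ q × t ≻[ D ] s ×
           (∀ a → a ∈ ante t → +∂ a ∈ P))))
  Ok P (-∂ q) =
    -Δ q ∈ P ×
    ((∀ r → r ∈ rules D → IsSD r → head r ≡ q →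
        ∃ λ a → a ∈ ante r × -∂ a ∈ P) ⊎
     +Δ (∼ q) ∈ P ⊎
     (∃ λ s → s ∈ rules D × head s ≡ ∼ q ×
        (∀ a → a ∈ ante s → +∂ a ∈ P) ×
        (∀ t → t ∈ rules D → IsSD t → head t ≡ q →
           (∃ λ a → a ∈ ante t × -∂ a ∈ P) ⊎ ¬ (t ≻[ D ] s))))

  data Derivation : List Tagged → Set where
    []   : Derivation Data.List.[]
    snoc : ∀ {P} t → Derivation P → Ok P t → Derivation (P Data.List.∷ʳ t)

  _⊢_ : Tagged → Set
  _⊢_ L = ∃ λ P → Derivation P × L ∈ P

infix 4 _⊢[_]
_⊢[_] : Theory → Tagged → Set
D ⊢[ L ] = _⊢_ D L

record Extension : Set₁ where
  constructor ext
  field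
    pΔ mΔ p∂ m∂ : Literal → Set
open Extension public

⊥ext : Extension
⊥ext = ext (λ _ → Data.Empty.⊥) (λ _ → Data.Empty.⊥) (λ _ → Data.Empty.⊥) (λ _ → Data.Empty.⊥)
  where import Data.Empty

T : Theory → Extension → Extension
T D (ext PΔ MΔ P∂ M∂) = ext pΔ' mΔ' p∂' m∂'
  where
  pΔ' : Literal → Set
  pΔ' q = q ∈ facts D ⊎
    (∃ λ r → r ∈ rules D × kind r ≡ strict × head r ≡ q × (∀ a → a ∈ ante r → PΔ a))
  mΔ' : Literal → Set
  mΔ' q = MΔ q ⊎
    ((∀ r → r ∈ rules D → kind r ≡ strict → head r ≡ q → ∃ λ a → a ∈ ante r × MΔ a) ×
     q ∉ facts D)
  p∂' : Literal → Set
  p∂' q = PΔ q ⊎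
    ((∃ λ r → r ∈ rules D × IsSD r × head r ≡ q × (∀ a → a ∈ ante r → P∂ a)) ×
     MΔ (∼ q) ×
     (∀ s → s ∈ rules D → head s ≡ ∼ q →
        (∃ λ a → a ∈ ante s × M∂ a) ⊎
        (∃ λ t → t ∈ rules D × IsSD t × head t ≡ q × (∀ a → a ∈ ante t → P∂ a) ×
           t ≻[ D ] s)))
  m∂' : Literal → Set
  m∂' q = MΔ q ×
    ((∀ r → r ∈ rules D → IsSD r → head r ≡ q → ∃ λ a → a ∈ ante r × M∂ a) ⊎
     PΔ (∼ q) ⊎
     (∃ λ s → s ∈ rules D × head s ≡ ∼ q × (∀ a → a ∈ ante s → P∂ a) ×
        (∀ t → t ∈ rules D → IsSD t → head t ≡ q →
           (∃ λ a → a ∈ ante t × M∂ a) ⊎ ¬ (t ≻[ D ] s))))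

_↑_ : Theory → ℕ → Extension
D ↑ zero    = ⊥ext
D ↑ suc n   = T D (D ↑ n)

E : Theory → Extension
E D = ext (λ q → ∃ λ n → pΔ (D ↑ n) q) (λ q → ∃ λ n → mΔ (D ↑ n) q)
          (λ q → ∃ λ n → p∂ (D ↑ n) q) (λ q → ∃ λ n → m∂ (D ↑ n) q)

{-# OPTIONS --safe #-}
-- Each derivation step is a T_D-step from the set of its predecessors, so by
-- monotonicity of T_D a derivation lies inside the stage indexed by its length.
-- Conversely the derivable tagged literals form a T_D-closed set, so every
-- stage lies inside it: each condition of T_D involves only finitely many
-- premises (the rules form a list and the guards of the universal conditions
-- are decidable), and finitely many derivations can be merged into one.
module Submission where

open import Defs
open import Data.Nat as ℕ using (zero; suc)
open import Data.Product using (_×_; ∃; _,_)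
open import Data.Sum as Sum using (_⊎_; inj₁; inj₂; [_,_])
open import Data.List using (List; []; _∷_; _∷ʳ_)
open import Data.List.Membership.Propositional using (_∈_)
open import Data.List.Membership.Propositional.Properties using (∈-++⁺ˡ; ∈-++⁺ʳ; ∈-++⁻)
open import Data.List.Relation.Unary.Any using (here; there)
open import Data.List.Relation.Binary.Subset.Propositional using (_⊆_)
open import Data.List.Relation.Binary.Subset.Propositional.Properties using (⊆-refl)
open import Function using (_∘_; id)
open import Function.Bundles using (_⇔_; mk⇔)
open import Relation.Binary.Definitions using (DecidableEquality)
open import Relation.Binary.PropositionalEquality using (_≡_; refl; cong)
open import Relation.Nullary using (Dec; yes; no; contradiction)
open import Relation.Nullary.Decidable using (map′)

_≟ˡ_ : DecidableEquality Literal
pos m ≟ˡ pos n = map′ (cong pos) (λ { refl → refl }) (m ℕ.≟ n)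
neg m ≟ˡ neg n = map′ (cong neg) (λ { refl → refl }) (m ℕ.≟ n)
pos _ ≟ˡ neg _ = no λ ()
neg _ ≟ˡ pos _ = no λ ()

isStrict? : ∀ r → Dec (kind r ≡ strict)
isStrict? r with kind r
... | strict     = yes refl
... | defeasible = no λ ()
... | defeater   = no λ ()

IsSD? : ∀ r → Dec (IsSD r)
IsSD? r with kind r
... | strict     = yes (inj₁ refl)
... | defeasible = yes (inj₂ refl)
... | defeater   = no λ { (inj₁ ()) ; (inj₂ ()) }

infix 4 _⊨_ _⊑_

_⊨_ : Extension → Tagged → Set
e ⊨ +Δ q = pΔ e q
e ⊨ -Δ q = mΔ e q
e ⊨ +∂ q = p∂ e q
e ⊨ -∂ q = m∂ e q

_⊑_ : Extension → Extension → Set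
e ⊑ e′ = ∀ x → e ⊨ x → e′ ⊨ x

extension : (Tagged → Set) → Extension
extension X = ext (X ∘ +Δ) (X ∘ -Δ) (X ∘ +∂) (X ∘ -∂)

⊨-extension⁺ : ∀ {X} x → X x → extension X ⊨ x
⊨-extension⁺ (+Δ _) = id
⊨-extension⁺ (-Δ _) = id
⊨-extension⁺ (+∂ _) = id
⊨-extension⁺ (-∂ _) = id

⊨-extension⁻ : ∀ {X} x → extension X ⊨ x → X x
⊨-extension⁻ (+Δ _) = id
⊨-extension⁻ (-Δ _) = id
⊨-extension⁻ (+∂ _) = id
⊨-extension⁻ (-∂ _) = id

⊥ext-least : ∀ {e} → ⊥ext ⊑ e
⊥ext-least (+Δ _) ()
⊥ext-least (-Δ _) ()
⊥ext-least (+∂ _) ()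
⊥ext-least (-∂ _) ()

module _ (D : Theory) where

  T-mono : ∀ {e e′} → e ⊑ e′ → T D e ⊑ T D e′
  T-mono {e} {e′} e⊑e′ = mono
    where
    all : (f : Literal → Tagged) {xs : List Literal} →
          (∀ a → a ∈ xs → e ⊨ f a) → ∀ a → a ∈ xs → e′ ⊨ f a
    all f as a a∈ = e⊑e′ (f a) (as a a∈)

    some : (f : Literal → Tagged) {xs : List Literal} →
           (∃ λ a → a ∈ xs × e ⊨ f a) → ∃ λ a → a ∈ xs × e′ ⊨ f a
    some f (a , a∈ , x) = a , a∈ , e⊑e′ (f a) x

    mono : T D e ⊑ T D e′
    mono (+Δ q) (inj₁ q∈F) = inj₁ q∈F
    mono (+Δ q) (inj₂ (r , r∈ , k , h , as)) = inj₂ (r , r∈ , k , h , all +Δ as)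
    mono (-Δ q) (inj₁ x) = inj₁ (e⊑e′ (-Δ q) x)
    mono (-Δ q) (inj₂ (f , q∉F)) = inj₂ ((λ r r∈ k h → some -Δ (f r r∈ k h)) , q∉F)
    mono (+∂ q) (inj₁ x) = inj₁ (e⊑e′ (+Δ q) x)
    mono (+∂ q) (inj₂ ((r , r∈ , sd , h , as) , x , f)) =
      inj₂ ((r , r∈ , sd , h , all +∂ as) , e⊑e′ (-Δ (∼ q)) x ,
            λ s s∈ hs → Sum.map (some -∂)
              (λ (t , t∈ , sdt , ht , ast , t≻s) → t , t∈ , sdt , ht , all +∂ ast , t≻s)
              (f s s∈ hs))
    mono (-∂ q) (x , inj₁ f) =
      e⊑e′ (-Δ q) x , inj₁ λ r r∈ sd h → some -∂ (f r r∈ sd h)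
    mono (-∂ q) (x , inj₂ (inj₁ y)) = e⊑e′ (-Δ q) x , inj₂ (inj₁ (e⊑e′ (+Δ (∼ q)) y))
    mono (-∂ q) (x , inj₂ (inj₂ (s , s∈ , hs , as , f))) =
      e⊑e′ (-Δ q) x ,
      inj₂ (inj₂ (s , s∈ , hs , all +∂ as ,
                  λ t t∈ sd ht → Sum.map₁ (some -∂) (f t t∈ sd ht)))

  ↑-ascending : ∀ n → D ↑ n ⊑ D ↑ suc n
  ↑-ascending zero    = ⊥ext-least
  ↑-ascending (suc n) = T-mono (↑-ascending n)

  ⟪_⟫ : List Tagged → Extension
  ⟪ P ⟫ = extension (_∈ P)

  Ok⇒T⟪⟫ : ∀ {P} t → Ok D P t → T D ⟪ P ⟫ ⊨ t
  Ok⇒T⟪⟫ (+Δ q) ok = ok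
  Ok⇒T⟪⟫ (-Δ q) (q∉F , f) = inj₂ (f , q∉F)
  Ok⇒T⟪⟫ (+∂ q) (inj₁ x) = inj₁ x
  Ok⇒T⟪⟫ (+∂ q) (inj₂ (r , x , f)) =
    inj₂ (r , x , λ s s∈ hs → Sum.map₂
      (λ (t , t∈ , sd , ht , t≻s , as) → t , t∈ , sd , ht , as , t≻s) (f s s∈ hs))
  Ok⇒T⟪⟫ (-∂ q) ok = ok

  -- The t ∈ P case comes from the -Δ component of T_D, which keeps what is already there.
  T⟪⟫⇒Ok : ∀ {P} t → T D ⟪ P ⟫ ⊨ t → t ∈ P ⊎ Ok D P t
  T⟪⟫⇒Ok (+Δ q) x = inj₂ x
  T⟪⟫⇒Ok (-Δ q) (inj₁ x) = inj₁ x
  T⟪⟫⇒Ok (-Δ q) (inj₂ (f , q∉F)) = inj₂ (q∉F , f)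
  T⟪⟫⇒Ok (+∂ q) (inj₁ x) = inj₂ (inj₁ x)
  T⟪⟫⇒Ok (+∂ q) (inj₂ (r , x , f)) =
    inj₂ (inj₂ (r , x , λ s s∈ hs → Sum.map₂
      (λ (t , t∈ , sd , ht , as , t≻s) → t , t∈ , sd , ht , t≻s , as) (f s s∈ hs)))
  T⟪⟫⇒Ok (-∂ q) x = inj₂ x

  derivation⊆stage : ∀ {P} → Derivation D P → ∃ λ n → ∀ x → x ∈ P → D ↑ n ⊨ x
  derivation⊆stage [] = 0 , λ _ ()
  derivation⊆stage (snoc {P} t d ok) with derivation⊆stage d
  ... | n , P⊆n = suc n , λ x x∈ → [ ↑-ascending n x ∘ P⊆n x , new x ] (∈-++⁻ P x∈)
    where
    new : ∀ x → x ∈ t ∷ [] → D ↑ suc n ⊨ x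
    new x (here refl) = T-mono (λ y → P⊆n y ∘ ⊨-extension⁻ {_∈ P} y) t (Ok⇒T⟪⟫ t ok)

  derivable⇒staged : ∀ {t} → D ⊢[ t ] → ∃ λ n → D ↑ n ⊨ t
  derivable⇒staged {t} (P , d , t∈P) with derivation⊆stage d
  ... | n , P⊆n = n , P⊆n t t∈P

  ⟪⟫-mono : ∀ {P Q} → P ⊆ Q → ⟪ P ⟫ ⊑ ⟪ Q ⟫
  ⟪⟫-mono {P} {Q} P⊆Q x = ⊨-extension⁺ {_∈ Q} x ∘ P⊆Q ∘ ⊨-extension⁻ {_∈ P} x

  DerivationAbove : List Tagged → (List Tagged → Set) → Set
  DerivationAbove P G = ∃ λ Q → Derivation D Q × P ⊆ Q × G Q

  extend : ∀ {P} t → Derivation D P → T D ⟪ P ⟫ ⊨ t → DerivationAbove P (t ∈_)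
  extend {P} t d x with T⟪⟫⇒Ok t x
  ... | inj₁ t∈P = P , d , id , t∈P
  ... | inj₂ ok  = P ∷ʳ t , snoc t d ok , ∈-++⁺ˡ , ∈-++⁺ʳ P (here refl)

  -- Replays the second derivation after the first, skipping steps already present.
  merge : ∀ {P Q} → Derivation D P → Derivation D Q → DerivationAbove P (Q ⊆_)
  merge dP [] = _ , dP , id , λ ()
  merge dP (snoc {Q} t dQ ok) with merge dP dQ
  ... | R , dR , P⊆R , Q⊆R with extend t dR (T-mono (⟪⟫-mono Q⊆R) t (Ok⇒T⟪⟫ t ok))
  ... | R′ , dR′ , R⊆R′ , t∈R′ =
    R′ , dR′ , R⊆R′ ∘ P⊆R , [ R⊆R′ ∘ Q⊆R , (λ { (here refl) → t∈R′ }) ] ∘ ∈-++⁻ Q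

  Established : (List Tagged → Set) → Set
  Established G = ∃ λ P → Derivation D P × ∀ {Q} → P ⊆ Q → G Q

  module Established where

    infixr 4 _⊗_

    always : ∀ {G} → (∀ {Q} → G Q) → Established G
    always g = [] , [] , λ _ → g

    map : ∀ {G H} → (∀ {Q} → G Q → H Q) → Established G → Established H
    map f (P , d , g) = P , d , f ∘ g

    _⊗_ : ∀ {G H} → Established G → Established H → Established (λ Q → G Q × H Q)
    (P , dP , g) ⊗ (Q , dQ , h) with merge dP dQ
    ... | R , dR , P⊆R , Q⊆R = R , dR , λ R⊆ → g (R⊆ ∘ P⊆R) , h (R⊆ ∘ Q⊆R)

    derived : ∀ {x} → D ⊢[ x ] → Established (x ∈_)
    derived (P , d , x∈P) = P , d , λ P⊆ → P⊆ x∈P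

    implied : ∀ {A : Set} {G} → Dec A → (A → Established G) → Established (λ Q → A → G Q)
    implied (yes a) g = map (λ x _ → x) (g a)
    implied (no ¬a) _ = always λ a → contradiction a ¬a

    all : ∀ {A : Set} {G : A → List Tagged → Set} xs →
          (∀ x → x ∈ xs → Established (G x)) → Established (λ Q → ∀ x → x ∈ xs → G x Q)
    all []       _ = always λ _ ()
    all {G = G} (y ∷ ys) g = map cons (g y (here refl) ⊗ all ys (λ x → g x ∘ there))
      where
      cons : ∀ {Q} → G y Q × (∀ x → x ∈ ys → G x Q) → ∀ x → x ∈ y ∷ ys → G x Q
      cons (gy , gys) x (here refl) = gy
      cons (gy , gys) x (there x∈)  = gys x x∈

    either : ∀ {G H} → Established G ⊎ Established H → Established (λ Q → G Q ⊎ H Q)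
    either = [ map inj₁ , map inj₂ ]

    premises : (f : Literal → Tagged) {xs : List Literal} → (∀ a → a ∈ xs → D ⊢[ f a ]) →
               Established (λ Q → ∀ a → a ∈ xs → f a ∈ Q)
    premises f {xs} ds = all xs λ a → derived ∘ ds a

    witness : (f : Literal → Tagged) {xs : List Literal} → (∃ λ a → a ∈ xs × D ⊢[ f a ]) →
              Established (λ Q → ∃ λ a → a ∈ xs × f a ∈ Q)
    witness f (a , a∈ , d) = map (λ x → a , a∈ , x) (derived d)

  open Established

  Derivable : Tagged → Set
  Derivable x = D ⊢[ x ]

  T-step-established : ∀ t → T D (extension Derivable) ⊨ t →
                       Established (λ P → T D ⟪ P ⟫ ⊨ t)
  T-step-established (+Δ q) (inj₁ q∈F) = always (inj₁ q∈F)
  T-step-established (+Δ q) (inj₂ (r , r∈ , k , h , ds)) =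
    map (λ as → inj₂ (r , r∈ , k , h , as)) (premises +Δ ds)
  T-step-established (-Δ q) (inj₁ d) = map inj₁ (derived d)
  T-step-established (-Δ q) (inj₂ (f , q∉F)) =
    map (λ g → inj₂ (g , q∉F))
      (all (rules D) λ r r∈ → implied (isStrict? r) λ k → implied (head r ≟ˡ q) λ h →
        witness -Δ (f r r∈ k h))
  T-step-established (+∂ q) (inj₁ d) = map inj₁ (derived d)
  T-step-established (+∂ q) (inj₂ ((r , r∈ , sd , h , ds) , d , f)) =
    map (λ (as , x , g) → inj₂ ((r , r∈ , sd , h , as) , x , g))
      (premises +∂ ds ⊗ derived d ⊗
       all (rules D) λ s s∈ → implied (head s ≟ˡ (∼ q)) λ hs →
         either (Sum.map (witness -∂)
           (λ (t , t∈ , sdt , ht , dt , t≻s) →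
              map (λ at → t , t∈ , sdt , ht , at , t≻s) (premises +∂ dt))
           (f s s∈ hs)))
  T-step-established (-∂ q) (d , inj₁ f) =
    map (λ (x , g) → x , inj₁ g)
      (derived d ⊗
       all (rules D) λ r r∈ → implied (IsSD? r) λ sd → implied (head r ≟ˡ q) λ h →
         witness -∂ (f r r∈ sd h))
  T-step-established (-∂ q) (d , inj₂ (inj₁ d∼)) =
    map (λ (x , y) → x , inj₂ (inj₁ y)) (derived d ⊗ derived d∼)
  T-step-established (-∂ q) (d , inj₂ (inj₂ (s , s∈ , hs , ds , f))) =
    map (λ (x , as , g) → x , inj₂ (inj₂ (s , s∈ , hs , as , g)))
      (derived d ⊗ premises +∂ ds ⊗
       all (rules D) λ t t∈ → implied (IsSD? t) λ sd → implied (head t ≟ˡ q) λ ht →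
         either (Sum.map (witness -∂) (λ t⊁s → always t⊁s) (f t t∈ sd ht)))

  T-closed : T D (extension Derivable) ⊑ extension Derivable
  T-closed t x with T-step-established t x
  ... | P , d , y with extend t d (y ⊆-refl)
  ... | Q , dQ , _ , t∈Q = ⊨-extension⁺ {Derivable} t (Q , dQ , t∈Q)

  stage⊑derivable : ∀ n → D ↑ n ⊑ extension Derivable
  stage⊑derivable zero    = ⊥ext-least
  stage⊑derivable (suc n) t = T-closed t ∘ T-mono (stage⊑derivable n) t

  derivable⇔staged : ∀ t → D ⊢[ t ] ⇔ ∃ λ n → D ↑ n ⊨ t
  derivable⇔staged t =
    mk⇔ derivable⇒staged λ (n , x) → ⊨-extension⁻ {Derivable} t (stage⊑derivable n t x)

theorem2p2 : (D : Theory) → WellFormed D → (q : Literal) →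
    (D ⊢[ +Δ q ] ⇔ pΔ (E D) q) ×
    (D ⊢[ -Δ q ] ⇔ mΔ (E D) q) ×
    (D ⊢[ +∂ q ] ⇔ p∂ (E D) q) ×
    (D ⊢[ -∂ q ] ⇔ m∂ (E D) q)
theorem2p2 D _ q =
  derivable⇔staged D (+Δ q) , derivable⇔staged D (-Δ q) ,
  derivable⇔staged D (+∂ q) , derivable⇔staged D (-∂ q)
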